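{- Let $\mu=(\mathrm{Val},(\mathcal P,\mathcal O),\varsigma)$ be a model with $\mathrm{Val}=\{0,0.5,1\}$ for the predicate symbols $\mathrm{input},\mathrm{echo}_1,\mathrm{echo}_2,\mathrm{output}$, whose semitopology is 3-twined, and suppose every axiom of $\mathrm{ThyCA}$ is valid in $\mu$. Then: (1) $\models\mathsf T\,\mathsf{Contraquorum}(\mathrm{input}(0)\wedge\mathrm{correct}(\mathrm{echo}_1))\vee\mathsf T\,\mathsf{Contraquorum}(\mathrm{input}(1)\wedge\mathrm{correct}(\mathrm{echo}_1))$; (2) $\models\mathsf T\,\mathsf{Contraquorum}\,\mathrm{echo}_1(0)\vee\mathsf T\,\mathsf{Contraquorum}\,\mathrm{echo}_1(1)$; (3) $\models\mathsf T\,\mathsf{Quorum}\,\mathrm{echo}_1(0)\vee\mathsf T\,\mathsf{Quorum}\,\mathrm{echo}_1(1)$; (4) $\models\mathsf{Everywhere}(\mathrm{echo}_2(0)\vee\mathrm{echo}_2(1))$; (5) $\models\mathsf T\,\mathsf{Quorum}(\mathrm{echo}_2(0)\vee\mathrm{echo}_2(1))$.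
   Context: Truth values: $\mathbf 3=\{\mathbf f,\mathbf b,\mathbf t\}$ totally ordered by $\mathbf f<\mathbf b<\mathbf t$; $\wedge,\vee$ are min and max, $\bigwedge,\bigvee$ are infimum and supremum. Negation: $\neg\mathbf t=\mathbf f$, $\neg\mathbf b=\mathbf b$, $\neg\mathbf f=\mathbf t$. Modalities: $\mathsf T x=\mathbf t$ if $x=\mathbf t$, else $\mathbf f$; $\mathsf B x=\mathbf t$ if $x=\mathbf b$, else $\mathbf f$; $\mathsf{TF}x=\mathbf t$ if $x\in\{\mathbf t,\mathbf f\}$, else $\mathbf f$. Weak implication $x\to_w y:=\neg x\vee y$; strong implication $x\to_s y:=\neg x\vee\mathsf T y$. Exclusive-or: $x\oplus y=\mathbf b$ if $x=\mathbf b$ or $y=\mathbf b$; otherwise $\mathbf t$ if $x\neq y$ and $\mathbf f$ if $x=y$. A truth value is valid iff it lies in $\{\mathbf t,\mathbf b\}$. A semitopology $(\mathcal P,\mathcal O)$ is a set $\mathcal P$ with a family $\mathcal O$ of subsets containing $\mathcal P$ and closed under arbitrary (including empty) unions; $\mathcal O^{\neq\emptyset}$ is the set of nonempty members. It is 3-twined if any three members of $\mathcal O^{\neq\emptyset}$ have nonempty intersection. For $f:\mathcal P\to\mathbf 3$: $\mathsf{Everywhere} f=\bigwedge_{p}f(p)$, $\mathsf{Somewhere} f=\bigvee_p f(p)$, $\mathsf{Quorum} f=\bigvee_{O\in\mathcal O^{\neq\emptyset}}\bigwedge_{p\in O}f(p)$, $\mathsf{Contraquorum} f=\bigwedge_{O\in\mathcal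 O^{\neq\emptyset}}\bigvee_{p\in O}f(p)$. Logic: a model $\mu=(\mathrm{Val},(\mathcal P,\mathcal O),\varsigma)$ consists of a nonempty set $\mathrm{Val}$, a semitopology, and for each predicate symbol $R$ a function $\varsigma(R):\mathcal P\to\mathrm{Val}\to\mathbf 3$. Formulas are built from atoms $R(t)$, value equalities $v\doteq v'$ (denoting $\mathbf t$ if $v=v'$, else $\mathbf f$), connectives $\neg,\wedge,\vee,\to_w,\to_s,\oplus$, modalities $\mathsf T,\mathsf B,\mathsf{TF}$, operators $\mathsf{Everywhere},\mathsf{Somewhere},\mathsf{Quorum},\mathsf{Contraquorum}$ and quantifiers over $\mathrm{Val}$. Denotation $[\![\phi]\!]:\mathcal P\to\mathbf 3$: $[\![R(v)]\!](p)=\varsigma(R)(p)(v)$; connectives and modalities act pointwise in $p$; $[\![\mathsf{Quorum}\,\phi]\!](p)=\mathsf{Quorum}([\![\phi]\!])$ for all $p$, likewise for the other three operators; $[\![\exists a.\phi]\!](p)=\bigvee_{v}[\![\phi[a:=v]]\!](p)$, $[\![\forall a.\phi]\!](p)=\bigwedge_{v}[\![\phi[a:=v]]\!](p)$; $[\![\exists_{01}a.\phi]\!](p)=\bigwedge_{v,v'}\big(([\![\phi[a:=v]]\!](p)\wedge[\![\phi[a:=v']]\!](p))\to_w (v\doteq v')\big)$. $p\models\phi$ iff $[\![\phi]\!](p)\in\{\mathbf t,\mathbf b\}$; $\models\phi$ iff $p\models\phi$ for all $p$. $\mathrm{correct}(R):=\forall a.\mathsf{TF}R(a)$, $\mathrm{incorrect}(R):=\forall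 a.\mathsf B R(a)$, $\mathrm{correct}(R_1,\dots,R_n):=\bigwedge_i\mathrm{correct}(R_i)$. Axioms with a free variable $a$ are universally quantified over $a$; an axiom is valid in $\mu$ if $\models$ it. $\mathrm{ThyCA}$ (with $\mathrm{Val}=\{0,0.5,1\}$) consists of: CaEcho1?: $\mathrm{echo}_1(a)\to_s\mathsf{Somewhere}\,\mathrm{input}(a)$; CaEcho2?: $\mathrm{echo}_2(a)\to_w\mathsf{Quorum}\,\mathrm{echo}_1(a)$; CaOutput?: $(\mathrm{output}(0)\to_w\mathsf{Quorum}\,\mathrm{echo}_2(0))\wedge(\mathrm{output}(1)\to_w\mathsf{Quorum}\,\mathrm{echo}_2(1))$; CaOutput'?: $\mathrm{output}(0.5)\to_w(\mathsf{Quorum}\,\mathrm{echo}_1(0)\wedge\mathsf{Quorum}\,\mathrm{echo}_1(1))$; CaCorrect: $\mathsf{Quorum}\,\mathrm{correct}(\mathrm{input},\mathrm{echo}_1,\mathrm{echo}_2,\mathrm{output})$; CaCorrect': $\mathrm{correct}(R)\vee\mathrm{incorrect}(R)$ for each $R\in\{\mathrm{input},\mathrm{echo}_1,\mathrm{echo}_2,\mathrm{output}\}$; CaInput: $(\mathrm{input}(0)\oplus\mathrm{input}(1))\wedge\neg\mathrm{input}(0.5)$; CaEcho2$_{01}$: $\exists_{01}a.\mathrm{echo}_2(a)$; CaEcho1!: $(\mathrm{input}(a)\vee\mathsf{Contraquorum}\,\mathrm{echo}_1(a))\to_w\mathrm{echo}_1(a)$; CaEcho2!: $(\exists a.\mathsf{Quorum}\,\mathrm{echo}_1(a))\to_w\exists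 a.\mathrm{echo}_2(a)$; CaOutput!: $\mathsf{Quorum}\,\mathrm{echo}_2(a)\to_w\mathrm{output}(a)$; CaOutput'!: $(\mathsf{Quorum}\,\mathrm{echo}_1(0)\wedge\mathsf{Quorum}\,\mathrm{echo}_1(1))\to_w\mathrm{output}(0.5)$. -}

module Defs where

open import Level using (Level; Setω)
open import Data.Empty using (⊥)
open import Data.Product using (Σ; _×_; _,_; proj₁)
open import Data.Unit using (⊤)
open import Data.Sum using (_⊎_)
open import Relation.Nullary using (¬_; Dec; yes; no)
open import Relation.Binary.PropositionalEquality using (_≡_; _≢_)
open import Axiom.ExcludedMiddle using (ExcludedMiddle)

-- Classical metatheory: the paper's infima/suprema over arbitrary sets
-- are computed using (informative) excluded middle, passed explicitly.

EM : Setω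
EM = ∀ {ℓ} → ExcludedMiddle ℓ

data 𝟑 : Set where
  𝐟 𝐛 𝐭 : 𝟑

infixr 6 _∧_
infixr 5 _∨_

_∧_ : 𝟑 → 𝟑 → 𝟑
𝐟 ∧ y = 𝐟
𝐛 ∧ 𝐟 = 𝐟
𝐛 ∧ y = 𝐛
𝐭 ∧ y = y

_∨_ : 𝟑 → 𝟑 → 𝟑
𝐟 ∨ y = y
𝐛 ∨ 𝐭 = 𝐭
𝐛 ∨ y = 𝐛
𝐭 ∨ y = 𝐭

¬₃ : 𝟑 → 𝟑
¬₃ 𝐭 = 𝐟
¬₃ 𝐛 = 𝐛
¬₃ 𝐟 = 𝐭

𝖳 : 𝟑 → 𝟑
𝖳 𝐭 = 𝐭
𝖳 _ = 𝐟

𝖡 : 𝟑 → 𝟑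
𝖡 𝐛 = 𝐭
𝖡 _ = 𝐟

𝖳𝖥 : 𝟑 → 𝟑
𝖳𝖥 𝐛 = 𝐟
𝖳𝖥 _ = 𝐭

_→w_ : 𝟑 → 𝟑 → 𝟑
x →w y = ¬₃ x ∨ y

_→s_ : 𝟑 → 𝟑 → 𝟑
x →s y = ¬₃ x ∨ 𝖳 y

_⊕_ : 𝟑 → 𝟑 → 𝟑
𝐛 ⊕ y = 𝐛
x ⊕ 𝐛 = 𝐛
𝐭 ⊕ 𝐭 = 𝐟
𝐭 ⊕ 𝐟 = 𝐭
𝐟 ⊕ 𝐭 = 𝐭
𝐟 ⊕ 𝐟 = 𝐟

Valid : 𝟑 → Set
Valid x = (x ≡ 𝐭) ⊎ (x ≡ 𝐛)

-- Infimum of an arbitrary family in the total order f < b < t: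
-- t if all members are t; otherwise b if no member is f; otherwise f.
⋀ : EM → ∀ {ℓ} {I : Set ℓ} → (I → 𝟑) → 𝟑
⋀ em {I = I} g with em {P = ∀ i → g i ≡ 𝐭}
... | yes _ = 𝐭
... | no _ with em {P = ∀ i → g i ≢ 𝐟}
...   | yes _ = 𝐛
...   | no _ = 𝐟

-- Supremum, via the order-reversing involution ¬.
⋁ : EM → ∀ {ℓ} {I : Set ℓ} → (I → 𝟑) → 𝟑
⋁ em g = ¬₃ (⋀ em (λ i → ¬₃ (g i)))

record Semitopology : Set₂ where
  field
    Pt     : Set
    IsOpen : (Pt → Set) → Set₁
    full   : IsOpen (λ _ → ⊤)
    unions : (I : Set) (U : I → Pt → Set) →
             (∀ i → IsOpen (U i)) → IsOpen (λ p → Σ I (λ i → U i p))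
  NEOpen : Set₁
  NEOpen = Σ (Pt → Set) (λ O → IsOpen O × Σ Pt O)

ThreeTwined : Semitopology → Set₁
ThreeTwined S = ∀ (O₁ O₂ O₃ : NEOpen) →
    Σ Pt (λ p → proj₁ O₁ p × proj₁ O₂ p × proj₁ O₃ p)
  where open Semitopology S

module _ (em : EM) (S : Semitopology) where
  open Semitopology S

  Everywhere : (Pt → 𝟑) → 𝟑
  Everywhere φ = ⋀ em φ

  Somewhere : (Pt → 𝟑) → 𝟑
  Somewhere φ = ⋁ em φ

  Quorum : (Pt → 𝟑) → 𝟑
  Quorum φ = ⋁ em (λ (O : NEOpen) →
                 ⋀ em (λ (q : Σ Pt (proj₁ O)) → φ (proj₁ q)))

  Contraquorum : (Pt → 𝟑) → 𝟑
  Contraquorum φ = ⋀ em (λ (O : NEOpen) →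
                 ⋁ em (λ (q : Σ Pt (proj₁ O)) → φ (proj₁ q)))

-- Values Val = {0, 0.5, 1}

data Val : Set where
  v0 vh v1 : Val

_≐_ : Val → Val → 𝟑
v0 ≐ v0 = 𝐭
vh ≐ vh = 𝐭
v1 ≐ v1 = 𝐭
_ ≐ _ = 𝐟

∀V : (Val → 𝟑) → 𝟑
∀V g = g v0 ∧ g vh ∧ g v1

∃V : (Val → 𝟑) → 𝟑
∃V g = g v0 ∨ g vh ∨ g v1

∃₀₁V : (Val → 𝟑) → 𝟑
∃₀₁V g = ∀V (λ v → ∀V (λ v' → (g v ∧ g v') →w (v ≐ v')))

record Model : Set₂ where
  field
    sem    : Semitopology
  open Semitopology sem public
  field
    input echo₁ echo₂ output : Pt → Val → 𝟑

module _ (M : Model) where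
  open Model M

  correct : (Pt → Val → 𝟑) → Pt → 𝟑
  correct R p = ∀V (λ a → 𝖳𝖥 (R p a))

  incorrect : (Pt → Val → 𝟑) → Pt → 𝟑
  incorrect R p = ∀V (λ a → 𝖡 (R p a))

  correct4 : Pt → 𝟑
  correct4 p = correct input p ∧ correct echo₁ p ∧ correct echo₂ p ∧ correct output p

  ⊨ : (Pt → 𝟑) → Set
  ⊨ φ = ∀ p → Valid (φ p)

module _ (em : EM) (M : Model) where
  open Model M

  private
    Q  = Quorum em sem
    CQ = Contraquorum em sem
    Sw = Somewhere em sem
    at : (Pt → Val → 𝟑) → Val → Pt → 𝟑
    at R a p = R p a

  -- All axioms of ThyCA are valid in M (free variable a universally quantified).
  record ThyCA : Set₁ where
    field
      CaEcho1?  : ∀ a → ⊨ M (λ p → echo₁ p a →s Sw (at input a))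
      CaEcho2?  : ∀ a → ⊨ M (λ p → echo₂ p a →w Q (at echo₁ a))
      CaOutput? : ⊨ M (λ p → (output p v0 →w Q (at echo₂ v0)) ∧ (output p v1 →w Q (at echo₂ v1)))
      CaOutput'? : ⊨ M (λ p → output p vh →w (Q (at echo₁ v0) ∧ Q (at echo₁ v1)))
      CaCorrect : ⊨ M (λ p → Q (correct4 M))
      CaCorrect'-input  : ⊨ M (λ p → correct M input p ∨ incorrect M input p)
      CaCorrect'-echo₁  : ⊨ M (λ p → correct M echo₁ p ∨ incorrect M echo₁ p)
      CaCorrect'-echo₂  : ⊨ M (λ p → correct M echo₂ p ∨ incorrect M echo₂ p)
      CaCorrect'-output : ⊨ M (λ p → correct M output p ∨ incorrect M output p)
      CaInput   : ⊨ M (λ p → (input p v0 ⊕ input p v1) ∧ ¬₃ (input p vh))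
      CaEcho2₀₁ : ⊨ M (λ p → ∃₀₁V (echo₂ p))
      CaEcho1!  : ∀ a → ⊨ M (λ p → (input p a ∨ CQ (at echo₁ a)) →w echo₁ p a)
      CaEcho2!  : ⊨ M (λ p → ∃V (λ a → Q (at echo₁ a)) →w ∃V (echo₂ p))
      CaOutput! : ∀ a → ⊨ M (λ p → Q (at echo₂ a) →w output p a)
      CaOutput'! : ⊨ M (λ p → (Q (at echo₁ v0) ∧ Q (at echo₁ v1)) →w output p vh)

  Concl : Set
  Concl =
      ⊨ M (λ p → 𝖳 (CQ (λ q → input q v0 ∧ correct M echo₁ q))
               ∨ 𝖳 (CQ (λ q → input q v1 ∧ correct M echo₁ q)))
    × ⊨ M (λ p → 𝖳 (CQ (at echo₁ v0)) ∨ 𝖳 (CQ (at echo₁ v1)))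
    × ⊨ M (λ p → 𝖳 (Q (at echo₁ v0)) ∨ 𝖳 (Q (at echo₁ v1)))
    × ⊨ M (λ p → Everywhere em sem (λ q → echo₂ q v0 ∨ echo₂ q v1))
    × ⊨ M (λ p → 𝖳 (Q (λ q → echo₂ q v0 ∨ echo₂ q v1)))

module Submission where

-- CaCorrect yields a nonempty open set O of points correct for every predicate.  There the
-- input is classical, so by CaInput each point of O inputs 0 or 1 (with echo₁ correct).
-- Three-twinedness makes any two opens meet inside O, so classically one of the two values,
-- say a, is truly input at a point of every nonempty open: this is (1).  CaEcho1! turns
-- such points into points where echo₁(a) is true, giving (2); CaEcho1! again makes echo₁(a)
-- valid everywhere, hence true on O, giving (3).  No point has echo₁(0.5) true, since by
-- CaEcho1? some input would be 0.5; so echo₂(0.5) is never true (CaEcho2?), and CaEcho2!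
-- together with (3) forces echo₂(0) or echo₂(1) wherever echo₂ is correct, which yields (4)
-- and, on O, (5).

open import Defs
open import Data.Empty using (⊥-elim)
open import Function using (_∘_)
open import Data.Product using (Σ; _×_; _,_; proj₁; proj₂)
open import Data.Sum as Sum using (_⊎_; inj₁; inj₂)
open import Relation.Nullary using (¬_; yes; no)
open import Relation.Binary.PropositionalEquality using (_≡_; _≢_; refl; cong)

𝐟-invalid : ¬ Valid 𝐟
𝐟-invalid (inj₁ ())
𝐟-invalid (inj₂ ())

valid⇒≢𝐟 : ∀ {x} → Valid x → x ≢ 𝐟
valid⇒≢𝐟 v refl = 𝐟-invalid v

≢𝐟⇒valid : ∀ {x} → x ≢ 𝐟 → Valid x
≢𝐟⇒valid {𝐟} x≢𝐟 = ⊥-elim (x≢𝐟 refl)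
≢𝐟⇒valid {𝐛} _ = inj₂ refl
≢𝐟⇒valid {𝐭} _ = inj₁ refl

invalid⇒≡𝐟 : ∀ {x} → ¬ Valid x → x ≡ 𝐟
invalid⇒≡𝐟 {𝐟} _ = refl
invalid⇒≡𝐟 {𝐛} ¬v = ⊥-elim (¬v (inj₂ refl))
invalid⇒≡𝐟 {𝐭} ¬v = ⊥-elim (¬v (inj₁ refl))

valid-≢𝐛⇒≡𝐭 : ∀ {x} → Valid x → x ≢ 𝐛 → x ≡ 𝐭
valid-≢𝐛⇒≡𝐭 (inj₁ x≡𝐭) _ = x≡𝐭
valid-≢𝐛⇒≡𝐭 (inj₂ x≡𝐛) x≢𝐛 = ⊥-elim (x≢𝐛 x≡𝐛)

¬₃-valid⁻ : ∀ {x} → Valid (¬₃ x) → x ≢ 𝐭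
¬₃-valid⁻ v refl = 𝐟-invalid v

¬₃-≡𝐭⁻ : ∀ {x} → ¬₃ x ≡ 𝐭 → x ≡ 𝐟
¬₃-≡𝐭⁻ {𝐟} _ = refl

¬₃-≡𝐟⁻ : ∀ {x} → ¬₃ x ≡ 𝐟 → x ≡ 𝐭
¬₃-≡𝐟⁻ {𝐭} _ = refl

∧-valid⁻ : ∀ {x y} → Valid (x ∧ y) → Valid x × Valid y
∧-valid⁻ {𝐟} v = ⊥-elim (𝐟-invalid v)
∧-valid⁻ {𝐛} {𝐟} v = ⊥-elim (𝐟-invalid v)
∧-valid⁻ {𝐛} {𝐛} v = v , v
∧-valid⁻ {𝐛} {𝐭} v = v , inj₁ refl
∧-valid⁻ {𝐭} v = inj₁ refl , v

∧-≡𝐭 : ∀ {x y} → x ≡ 𝐭 → y ≡ 𝐭 → x ∧ y ≡ 𝐭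
∧-≡𝐭 refl refl = refl

∧-≡𝐭⁻ : ∀ {x y} → x ∧ y ≡ 𝐭 → x ≡ 𝐭 × y ≡ 𝐭
∧-≡𝐭⁻ {𝐭} y≡𝐭 = refl , y≡𝐭
∧-≡𝐭⁻ {𝐛} {𝐟} ()
∧-≡𝐭⁻ {𝐛} {𝐛} ()
∧-≡𝐭⁻ {𝐛} {𝐭} ()

∨-≡𝐭ˡ : ∀ {x y} → x ≡ 𝐭 → x ∨ y ≡ 𝐭
∨-≡𝐭ˡ refl = refl

∨-≡𝐭ʳ : ∀ {x y} → y ≡ 𝐭 → x ∨ y ≡ 𝐭
∨-≡𝐭ʳ {𝐟} refl = refl
∨-≡𝐭ʳ {𝐛} refl = refl
∨-≡𝐭ʳ {𝐭} refl = refl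

∨-validˡ : ∀ {x y} → Valid x → Valid (x ∨ y)
∨-validˡ {𝐟} v = ⊥-elim (𝐟-invalid v)
∨-validˡ {𝐛} {𝐟} v = v
∨-validˡ {𝐛} {𝐛} v = v
∨-validˡ {𝐛} {𝐭} v = inj₁ refl
∨-validˡ {𝐭} v = v

∨-validʳ : ∀ {x y} → Valid y → Valid (x ∨ y)
∨-validʳ {𝐟} v = v
∨-validʳ {𝐛} {𝐟} v = ⊥-elim (𝐟-invalid v)
∨-validʳ {𝐛} {𝐛} v = v
∨-validʳ {𝐛} {𝐭} v = v
∨-validʳ {𝐭} v = inj₁ refl

∨-valid⁻ : ∀ {x y} → Valid (x ∨ y) → Valid x ⊎ Valid y
∨-valid⁻ {𝐟} v = inj₂ v
∨-valid⁻ {𝐛} v = inj₁ (inj₂ refl)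
∨-valid⁻ {𝐭} v = inj₁ (inj₁ refl)

𝖳-valid⁻ : ∀ {x} → Valid (𝖳 x) → x ≡ 𝐭
𝖳-valid⁻ {𝐟} v = ⊥-elim (𝐟-invalid v)
𝖳-valid⁻ {𝐛} v = ⊥-elim (𝐟-invalid v)
𝖳-valid⁻ {𝐭} v = refl

𝖳∨𝖳-valid : ∀ {x y} → x ≡ 𝐭 ⊎ y ≡ 𝐭 → Valid (𝖳 x ∨ 𝖳 y)
𝖳∨𝖳-valid (inj₁ x≡𝐭) = inj₁ (∨-≡𝐭ˡ (cong 𝖳 x≡𝐭))
𝖳∨𝖳-valid (inj₂ y≡𝐭) = inj₁ (∨-≡𝐭ʳ (cong 𝖳 y≡𝐭))

𝖡-valid⁻ : ∀ {x} → Valid (𝖡 x) → x ≡ 𝐛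
𝖡-valid⁻ {𝐟} v = ⊥-elim (𝐟-invalid v)
𝖡-valid⁻ {𝐛} v = refl
𝖡-valid⁻ {𝐭} v = ⊥-elim (𝐟-invalid v)

𝖳𝖥-valid⁻ : ∀ {x} → Valid (𝖳𝖥 x) → x ≢ 𝐛
𝖳𝖥-valid⁻ v refl = 𝐟-invalid v

𝖳𝖥-≡𝐭 : ∀ {x} → x ≢ 𝐛 → 𝖳𝖥 x ≡ 𝐭
𝖳𝖥-≡𝐭 {𝐟} _ = refl
𝖳𝖥-≡𝐭 {𝐛} x≢𝐛 = ⊥-elim (x≢𝐛 refl)
𝖳𝖥-≡𝐭 {𝐭} _ = refl

⊕-valid⁻ : ∀ {x y} → x ≢ 𝐛 → y ≢ 𝐛 → Valid (x ⊕ y) → x ≡ 𝐭 ⊎ y ≡ 𝐭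
⊕-valid⁻ {𝐭} _ _ _ = inj₁ refl
⊕-valid⁻ {𝐛} x≢𝐛 _ _ = ⊥-elim (x≢𝐛 refl)
⊕-valid⁻ {𝐟} {𝐭} _ _ _ = inj₂ refl
⊕-valid⁻ {𝐟} {𝐛} _ y≢𝐛 _ = ⊥-elim (y≢𝐛 refl)
⊕-valid⁻ {𝐟} {𝐟} _ _ v = ⊥-elim (𝐟-invalid v)

-- x →w y is valid whenever x = 𝐛, so modus ponens needs a true antecedent.
→w-mp : ∀ {x y} → x ≡ 𝐭 → Valid (x →w y) → Valid y
→w-mp refl v = v

→s-mp : ∀ {x y} → x ≡ 𝐭 → Valid (x →s y) → y ≡ 𝐭
→s-mp refl v = 𝖳-valid⁻ v

∀V-valid⁻ : ∀ {g} → Valid (∀V g) → ∀ a → Valid (g a)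
∀V-valid⁻ v v0 = proj₁ (∧-valid⁻ v)
∀V-valid⁻ {g} v vh = proj₁ (∧-valid⁻ (proj₂ (∧-valid⁻ {g v0} v)))
∀V-valid⁻ {g} v v1 = proj₂ (∧-valid⁻ (proj₂ (∧-valid⁻ {g v0} v)))

∀V-≡𝐭 : ∀ {g} → (∀ a → g a ≡ 𝐭) → ∀V g ≡ 𝐭
∀V-≡𝐭 g≡𝐭 = ∧-≡𝐭 (g≡𝐭 v0) (∧-≡𝐭 (g≡𝐭 vh) (g≡𝐭 v1))

∃V-≡𝐭 : ∀ {g} a → g a ≡ 𝐭 → ∃V g ≡ 𝐭
∃V-≡𝐭 v0 e = ∨-≡𝐭ˡ e
∃V-≡𝐭 {g} vh e = ∨-≡𝐭ʳ {g v0} (∨-≡𝐭ˡ e)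
∃V-≡𝐭 {g} v1 e = ∨-≡𝐭ʳ {g v0} (∨-≡𝐭ʳ {g vh} e)

∃V-valid⁻ : ∀ {g} → Valid (∃V g) → Σ Val (λ a → Valid (g a))
∃V-valid⁻ v with ∨-valid⁻ v
... | inj₁ v₀ = v0 , v₀
... | inj₂ v′ with ∨-valid⁻ v′
...   | inj₁ vₕ = vh , vₕ
...   | inj₂ v₁ = v1 , v₁

module _ (em : EM) {ℓ} {I : Set ℓ} {g : I → 𝟑} where

  ⋀-≡𝐭 : (∀ i → g i ≡ 𝐭) → ⋀ em g ≡ 𝐭
  ⋀-≡𝐭 all≡𝐭 with em {P = ∀ i → g i ≡ 𝐭}
  ... | yes _ = refl
  ... | no ¬all≡𝐭 = ⊥-elim (¬all≡𝐭 all≡𝐭)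

  ⋀-valid : (∀ i → Valid (g i)) → Valid (⋀ em g)
  ⋀-valid allValid with em {P = ∀ i → g i ≡ 𝐭}
  ... | yes _ = inj₁ refl
  ... | no _ with em {P = ∀ i → g i ≢ 𝐟}
  ...   | yes _ = inj₂ refl
  ...   | no ¬all≢𝐟 = ⊥-elim (¬all≢𝐟 (λ i → valid⇒≢𝐟 (allValid i)))

  ⋀-valid⁻ : Valid (⋀ em g) → ∀ i → Valid (g i)
  ⋀-valid⁻ v i with em {P = ∀ i → g i ≡ 𝐭}
  ... | yes all≡𝐭 = inj₁ (all≡𝐭 i)
  ... | no _ with em {P = ∀ i → g i ≢ 𝐟}
  ...   | yes all≢𝐟 = ≢𝐟⇒valid (all≢𝐟 i)
  ...   | no _ = ⊥-elim (𝐟-invalid v)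

  ⋀-≡𝐟 : Σ I (λ i → g i ≡ 𝐟) → ⋀ em g ≡ 𝐟
  ⋀-≡𝐟 (i , gi≡𝐟) = invalid⇒≡𝐟 (λ v → valid⇒≢𝐟 (⋀-valid⁻ v i) gi≡𝐟)

  ⋀-≡𝐟⁻ : ⋀ em g ≡ 𝐟 → Σ I (λ i → g i ≡ 𝐟)
  ⋀-≡𝐟⁻ ⋀≡𝐟 with em {P = Σ I (λ i → g i ≡ 𝐟)}
  ... | yes witness = witness
  ... | no ¬witness =
    ⊥-elim (valid⇒≢𝐟 (⋀-valid (λ i → ≢𝐟⇒valid (λ e → ¬witness (i , e)))) ⋀≡𝐟)

module _ (em : EM) {ℓ} {I : Set ℓ} {g : I → 𝟑} where

  ⋁-≡𝐭 : Σ I (λ i → g i ≡ 𝐭) → ⋁ em g ≡ 𝐭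
  ⋁-≡𝐭 (i , gi≡𝐭) = cong ¬₃ (⋀-≡𝐟 em (i , cong ¬₃ gi≡𝐭))

  ⋁-≡𝐭⁻ : ⋁ em g ≡ 𝐭 → Σ I (λ i → g i ≡ 𝐭)
  ⋁-≡𝐭⁻ ⋁≡𝐭 with ⋀-≡𝐟⁻ em (¬₃-≡𝐭⁻ ⋁≡𝐭)
  ... | i , ¬gi≡𝐟 = i , ¬₃-≡𝐟⁻ ¬gi≡𝐟

  ⋁-valid⁻ : Valid (⋁ em g) → Σ I (λ i → Valid (g i))
  ⋁-valid⁻ v with em {P = Σ I (λ i → Valid (g i))}
  ... | yes witness = witness
  ... | no ¬witness =
    ⊥-elim (¬₃-valid⁻ v (⋀-≡𝐭 em λ i → cong ¬₃ (invalid⇒≡𝐟 (λ vi → ¬witness (i , vi)))))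

module _ (S : Semitopology) where
  open Semitopology S

  HitsEveryOpen : (Pt → Set) → Set₁
  HitsEveryOpen P = ∀ (O : NEOpen) → Σ Pt (λ p → proj₁ O p × P p)

  threeTwined⇒meet : ThreeTwined S → (O O′ : NEOpen) → Σ Pt (λ p → proj₁ O p × proj₁ O′ p)
  threeTwined⇒meet tw O O′ with tw O O O′
  ... | p , p∈O , _ , p∈O′ = p , p∈O , p∈O′

  -- Any two nonempty opens O₁, O₂ meet inside O, so P cannot miss O₁ while Q misses O₂.
  threeTwined-dichotomy : EM → ThreeTwined S → (O : NEOpen) {P Q : Pt → Set} →
                          (∀ p → proj₁ O p → P p ⊎ Q p) → HitsEveryOpen P ⊎ HitsEveryOpen Q
  threeTwined-dichotomy em tw O {P} {Q} P∪Q with em {P = HitsEveryOpen Q}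
  ... | yes hitsQ = inj₂ hitsQ
  ... | no ¬hitsQ = inj₁ hitsP
    where
    hitsP : HitsEveryOpen P
    hitsP O₁ with em {P = Σ Pt (λ p → proj₁ O₁ p × P p)}
    ... | yes hit = hit
    ... | no ¬hit = ⊥-elim (¬hitsQ hitsQ)
      where
      hitsQ : HitsEveryOpen Q
      hitsQ O₂ with tw O₁ O₂ O
      ... | r , r∈O₁ , r∈O₂ , r∈O with P∪Q r r∈O
      ...   | inj₁ Pr = ⊥-elim (¬hit (r , r∈O₁ , Pr))
      ...   | inj₂ Qr = r , r∈O₂ , Qr

  module _ (em : EM) {φ : Pt → 𝟑} where

    quorum-≡𝐭 : (O : NEOpen) → (∀ p → proj₁ O p → φ p ≡ 𝐭) → Quorum em S φ ≡ 𝐭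
    quorum-≡𝐭 O φ≡𝐭 = ⋁-≡𝐭 em (O , ⋀-≡𝐭 em (λ (p , p∈O) → φ≡𝐭 p p∈O))

    quorum-valid⁻ : Valid (Quorum em S φ) → Σ NEOpen (λ O → ∀ p → proj₁ O p → Valid (φ p))
    quorum-valid⁻ v with ⋁-valid⁻ em v
    ... | O , vO = O , λ p p∈O → ⋀-valid⁻ em vO (p , p∈O)

    contraquorum-≡𝐭 : HitsEveryOpen (λ p → φ p ≡ 𝐭) → Contraquorum em S φ ≡ 𝐭
    contraquorum-≡𝐭 hits =
      ⋀-≡𝐭 em (λ O → let (p , p∈O , φp≡𝐭) = hits O in ⋁-≡𝐭 em ((p , p∈O) , φp≡𝐭))

module _ (M : Model) (R : Model.Pt M → Val → 𝟑) {p : Model.Pt M} where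

  correct-valid⁻ : Valid (correct M R p) → ∀ a → R p a ≢ 𝐛
  correct-valid⁻ v a = 𝖳𝖥-valid⁻ (∀V-valid⁻ {λ b → 𝖳𝖥 (R p b)} v a)

  correct-≡𝐭 : (∀ a → R p a ≢ 𝐛) → correct M R p ≡ 𝐭
  correct-≡𝐭 classical = ∀V-≡𝐭 (λ a → 𝖳𝖥-≡𝐭 (classical a))

  incorrect-valid⁻ : Valid (incorrect M R p) → ∀ a → R p a ≡ 𝐛
  incorrect-valid⁻ v a = 𝖡-valid⁻ (∀V-valid⁻ {λ b → 𝖡 (R p b)} v a)

module _ (M : Model) where
  open Model M

  correct4-valid⁻ : ∀ {p} → Valid (correct4 M p) →
                    Valid (correct M input p) × Valid (correct M echo₁ p) ×
                    Valid (correct M echo₂ p) × Valid (correct M output p)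
  correct4-valid⁻ {p} v with ∧-valid⁻ {correct M input p} v
  ... | vᵢ , v′ with ∧-valid⁻ {correct M echo₁ p} v′
  ...   | v₁ , v″ with ∧-valid⁻ {correct M echo₂ p} v″
  ...     | v₂ , vₒ = vᵢ , v₁ , v₂ , vₒ

module CorrectQuorum (em : EM) (M : Model) (tw : ThreeTwined (Model.sem M)) (thy : ThyCA em M)
  (correctOpen : Σ (Semitopology.NEOpen (Model.sem M)) (λ O → ∀ p → proj₁ O p → Valid (correct4 M p)))
  where
  open Model M
  open ThyCA thy

  Oc : NEOpen
  Oc = proj₁ correctOpen

  private
    correct-on-Oc : ∀ {p} → proj₁ Oc p →
                    Valid (correct M input p) × Valid (correct M echo₁ p) ×
                    Valid (correct M echo₂ p) × Valid (correct M output p)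
    correct-on-Oc {p} p∈Oc = correct4-valid⁻ M (proj₂ correctOpen p p∈Oc)

  input-classical : ∀ {p} → proj₁ Oc p → ∀ a → input p a ≢ 𝐛
  input-classical p∈Oc = correct-valid⁻ M input (proj₁ (correct-on-Oc p∈Oc))

  echo₁-classical : ∀ {p} → proj₁ Oc p → ∀ a → echo₁ p a ≢ 𝐛
  echo₁-classical p∈Oc = correct-valid⁻ M echo₁ (proj₁ (proj₂ (correct-on-Oc p∈Oc)))

  echo₂-classical : ∀ {p} → proj₁ Oc p → ∀ a → echo₂ p a ≢ 𝐛
  echo₂-classical p∈Oc = correct-valid⁻ M echo₂ (proj₁ (proj₂ (proj₂ (correct-on-Oc p∈Oc))))

  input∧correct-echo₁ : Val → Pt → 𝟑
  input∧correct-echo₁ a p = input p a ∧ correct M echo₁ p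

  Decided : Val → Set₁
  Decided a = HitsEveryOpen sem (λ p → input∧correct-echo₁ a p ≡ 𝐭)

  decided : Decided v0 ⊎ Decided v1
  decided = threeTwined-dichotomy sem em tw Oc inputs
    where
    inputs : ∀ p → proj₁ Oc p → input∧correct-echo₁ v0 p ≡ 𝐭 ⊎ input∧correct-echo₁ v1 p ≡ 𝐭
    inputs p p∈Oc =
      Sum.map (λ e → ∧-≡𝐭 e echo₁-correct) (λ e → ∧-≡𝐭 e echo₁-correct)
        (⊕-valid⁻ (input-classical p∈Oc v0) (input-classical p∈Oc v1) (proj₁ (∧-valid⁻ (CaInput p))))
      where
      echo₁-correct : correct M echo₁ p ≡ 𝐭
      echo₁-correct = correct-≡𝐭 M echo₁ (echo₁-classical p∈Oc)

  module _ {a : Val} (d : Decided a) where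

    contraquorum-input : Contraquorum em sem (input∧correct-echo₁ a) ≡ 𝐭
    contraquorum-input = contraquorum-≡𝐭 sem em d

    echo₁-hitsEveryOpen : HitsEveryOpen sem (λ p → echo₁ p a ≡ 𝐭)
    echo₁-hitsEveryOpen O with d O
    ... | p , p∈O , e with ∧-≡𝐭⁻ {input p a} e
    ...   | input≡𝐭 , correct≡𝐭 =
      p , p∈O , valid-≢𝐛⇒≡𝐭 (→w-mp (∨-≡𝐭ˡ input≡𝐭) (CaEcho1! a p))
                            (correct-valid⁻ M echo₁ (inj₁ correct≡𝐭) a)

    contraquorum-echo₁ : Contraquorum em sem (λ p → echo₁ p a) ≡ 𝐭
    contraquorum-echo₁ = contraquorum-≡𝐭 sem em echo₁-hitsEveryOpen

    echo₁-valid : ∀ p → Valid (echo₁ p a)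
    echo₁-valid p = →w-mp (∨-≡𝐭ʳ {input p a} contraquorum-echo₁) (CaEcho1! a p)

    quorum-echo₁ : Quorum em sem (λ p → echo₁ p a) ≡ 𝐭
    quorum-echo₁ =
      quorum-≡𝐭 sem em Oc (λ p p∈Oc → valid-≢𝐛⇒≡𝐭 (echo₁-valid p) (echo₁-classical p∈Oc a))

  input-vh≢𝐭 : ∀ p → input p vh ≢ 𝐭
  input-vh≢𝐭 p = ¬₃-valid⁻ (proj₂ (∧-valid⁻ (CaInput p)))

  echo₁-vh≢𝐭 : ∀ p → echo₁ p vh ≢ 𝐭
  echo₁-vh≢𝐭 p e with ⋁-≡𝐭⁻ em (→s-mp e (CaEcho1? vh p))
  ... | q , input≡𝐭 = input-vh≢𝐭 q input≡𝐭

  quorum-echo₁-vh-invalid : ¬ Valid (Quorum em sem (λ p → echo₁ p vh))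
  quorum-echo₁-vh-invalid v with quorum-valid⁻ sem em v
  ... | O , valid-on-O with threeTwined⇒meet sem tw O Oc
  ...   | r , r∈O , r∈Oc =
    echo₁-vh≢𝐭 r (valid-≢𝐛⇒≡𝐭 (valid-on-O r r∈O) (echo₁-classical r∈Oc vh))

  echo₂-vh≢𝐭 : ∀ p → echo₂ p vh ≢ 𝐭
  echo₂-vh≢𝐭 p e = quorum-echo₁-vh-invalid (→w-mp e (CaEcho2? vh p))

  ∃-quorum-echo₁ : ∃V (λ a → Quorum em sem (λ q → echo₁ q a)) ≡ 𝐭
  ∃-quorum-echo₁ =
    Sum.[ ∃V-≡𝐭 {quorumEcho₁} v0 ∘ quorum-echo₁ , ∃V-≡𝐭 {quorumEcho₁} v1 ∘ quorum-echo₁ ]′ decided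
    where
    quorumEcho₁ : Val → 𝟑
    quorumEcho₁ a = Quorum em sem (λ q → echo₁ q a)

  echo₂-0∨1-valid : ∀ p → Valid (echo₂ p v0 ∨ echo₂ p v1)
  echo₂-0∨1-valid p with ∨-valid⁻ (CaCorrect'-echo₂ p)
  ... | inj₂ isIncorrect = ∨-validˡ (inj₂ (incorrect-valid⁻ M echo₂ isIncorrect v0))
  ... | inj₁ isCorrect with ∃V-valid⁻ {echo₂ p} (→w-mp ∃-quorum-echo₁ (CaEcho2! p))
  ...   | v0 , v = ∨-validˡ v
  ...   | v1 , v = ∨-validʳ v
  ...   | vh , v =
    ⊥-elim (echo₂-vh≢𝐭 p (valid-≢𝐛⇒≡𝐭 v (correct-valid⁻ M echo₂ isCorrect vh)))

  quorum-echo₂-0∨1 : Quorum em sem (λ p → echo₂ p v0 ∨ echo₂ p v1) ≡ 𝐭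
  quorum-echo₂-0∨1 = quorum-≡𝐭 sem em Oc λ p p∈Oc →
    Sum.[ (λ v → ∨-≡𝐭ˡ (valid-≢𝐛⇒≡𝐭 v (echo₂-classical p∈Oc v0)))
        , (λ v → ∨-≡𝐭ʳ (valid-≢𝐛⇒≡𝐭 v (echo₂-classical p∈Oc v1))) ]′
      (∨-valid⁻ (echo₂-0∨1-valid p))

corollary5p16 : (em : EM) (M : Model) → ThreeTwined (Model.sem M) → ThyCA em M → Concl em M
corollary5p16 em M tw thy =
    (λ p → let open At p in 𝖳∨𝖳-valid (Sum.map contraquorum-input contraquorum-input decided))
  , (λ p → let open At p in 𝖳∨𝖳-valid (Sum.map contraquorum-echo₁ contraquorum-echo₁ decided))
  , (λ p → let open At p in 𝖳∨𝖳-valid (Sum.map quorum-echo₁ quorum-echo₁ decided))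
  , (λ p → let open At p in ⋀-valid em echo₂-0∨1-valid)
  , (λ p → let open At p in inj₁ (cong 𝖳 quorum-echo₂-0∨1))
  where
  -- CaCorrect is a constant formula; any point serves to read off its validity.
  module At (p : Model.Pt M) =
    CorrectQuorum em M tw thy (quorum-valid⁻ (Model.sem M) em (ThyCA.CaCorrect thy p))
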